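{- Starting from a star with a white center and $B$ black leaves, the total time for any sequence of $s$ splits and at most $B+s$ contractions, when using a data structure that takes worst-case $O(|M|)$ time for $\mathrm{split}(u,M)$ and worst-case $O(\min\{d(u),d(v)\})$ time for $\mathrm{contract}(v,u)$, is $O(s+B\log B)$.
   Context: The tree is rooted; nodes are black or white; $N(u)$ is the neighbour set of $u$ (including its parent), $d(u)=|N(u)|$. $\mathrm{split}(u,M)$: given a white node $u$ with $d(u)\ge2$ and $M\subset N(u)$ with $1\le |M|\le \frac12 d(u)$, insert a new white child $v$ of $u$; let $M'=M$ if $u$ is the root or $\mathrm{parent}(u)\notin M$, and $M'=N(u)\setminus M$ otherwise; make each node of $M'$ a child of $v$. $\mathrm{contract}(v,u)$ for an edge between child $v$ and parent $u$: remove $v$, make all its children children of $u$, and turn $u$ black. -}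

module Defs where

open import Data.Nat using (ℕ; zero; suc; _+_; _*_; _≤_; _≡ᵇ_; _⊔_; _⊓_)
open import Data.Nat.Logarithm using (⌈log₂_⌉)
open import Data.Bool using (Bool; true; false; not; if_then_else_; _∧_)
open import Data.Maybe using (Maybe; just; nothing)
open import Data.List using (List; []; _∷_; _++_; length; filterᵇ; upTo)
open import Data.Bool.ListAction using (any)
open import Data.List.Membership.Propositional using (_∈_)
open import Data.List.Relation.Unary.All using (All)
open import Data.List.Relation.Unary.Unique.Propositional using (Unique)
open import Relation.Binary.PropositionalEquality using (_≡_)

-- A state of the rooted black/white tree:
--   nodes : the nodes currently present
--   par   : parent pointer (nothing = root)
--   black : colour (true = black, false = white)
--   fresh : an identifier larger than every identifier ever used
record State : Set where
  constructor st
  field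
    nodes : List ℕ
    par   : ℕ → Maybe ℕ
    black : ℕ → Bool
    fresh : ℕ
open State public

memᵇ : ℕ → List ℕ → Bool
memᵇ w xs = any (λ x → x ≡ᵇ w) xs

isJust≡ : Maybe ℕ → ℕ → Bool
isJust≡ (just p) u = p ≡ᵇ u
isJust≡ nothing  u = false

children : State → ℕ → List ℕ
children S u = filterᵇ (λ w → isJust≡ (par S w) u) (nodes S)

parentList : Maybe ℕ → List ℕ
parentList (just p) = p ∷ []
parentList nothing  = []

N : State → ℕ → List ℕ
N S u = parentList (par S u) ++ children S u

d : State → ℕ → ℕ
d S u = length (N S u)

-- Initial star: white centre 0 (root), black leaves 1..B.
star : ℕ → State
star B = st (upTo (suc B))
            (λ w → if w ≡ᵇ 0 then nothing else just 0)
            (λ w → not (w ≡ᵇ 0))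
            (suc B)

rootOrParentNotIn : State → ℕ → List ℕ → Bool
rootOrParentNotIn S u M with par S u
... | nothing = true
... | just p  = not (memᵇ p M)

M′ : State → ℕ → List ℕ → List ℕ
M′ S u M = if rootOrParentNotIn S u M then M
           else filterᵇ (λ w → not (memᵇ w M)) (N S u)

splitState : State → ℕ → List ℕ → State
splitState S u M =
  st (v ∷ nodes S)
     (λ w → if w ≡ᵇ v then just u
            else if memᵇ w (M′ S u M) then just v
            else par S w)
     (λ w → if w ≡ᵇ v then false else black S w)
     (suc v)
  where v = fresh S

contractState : State → ℕ → ℕ → State
contractState S v u =
  st (filterᵇ (λ w → not (w ≡ᵇ v)) (nodes S))
     (λ w → if isJust≡ (par S w) v then just u else par S w)
     (λ w → if w ≡ᵇ u then true else black S w)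
     (fresh S)

data Op : Set where
  splitOp    : ℕ → List ℕ → Op
  contractOp : ℕ → ℕ → Op

data Step : State → Op → State → ℕ → Set where
  split : ∀ {S u M} →
    u ∈ nodes S → black S u ≡ false → 2 ≤ d S u →
    Unique M → All (λ w → w ∈ N S u) M →
    1 ≤ length M → 2 * length M ≤ d S u →
    Step S (splitOp u M) (splitState S u M) (length M)
  contract : ∀ {S v u} →
    v ∈ nodes S → u ∈ nodes S → par S v ≡ just u →
    Step S (contractOp v u) (contractState S v u) (d S u ⊓ d S v)

data Exec : State → List Op → State → ℕ → Set where
  done : ∀ {S} → Exec S [] S 0
  step : ∀ {S o S′ ops S″ c c′} →
    Step S o S′ c → Exec S′ ops S″ c′ → Exec S (o ∷ ops) S″ (c + c′)

isSplit : Op → Bool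
isSplit (splitOp _ _) = true
isSplit (contractOp _ _) = false

numSplits : List Op → ℕ
numSplits ops = length (filterᵇ isSplit ops)

numContracts : List Op → ℕ
numContracts ops = length (filterᵇ (λ o → not (isSplit o)) ops)

-- Every node x carries a mass m(x) with d(x) ≤ m(x) + 2; initially the white centre
-- of the star has mass B and the leaves mass 0, and the total mass never grows. The
-- potential of a node of mass n is nlog n = n ⌈log₂ n⌉, collected in Φwhite over white
-- nodes and in Φblack over black ones. For every legal step of cost c we show
--     c + Φwhite′ + Φblack ≤ 2 + Φwhite + Φblack′.
-- A split(u, M) hands |M′| - 1 of u's mass to the new node v; since |M| ≤ 1 + min of the
-- two parts, the loss of white potential pays for it. A contraction(v, u) merges the
-- masses of u and v into the (now black) node u, and merging two masses raises nlog by
-- at least their minimum, which pays for min(d(u), d(v)). Summing over an execution,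
-- cost ≤ 2·#ops + Φwhite(start) + Φblack(end) ≤ 2·#ops + 2 B ⌈log₂ B⌉, and with
-- #ops ≤ 2s + B this gives cost ≤ 4 (1 + s + B ⌈log₂ B⌉).
module Submission where

open import Defs
open import Data.Nat using (ℕ; suc; _+_; _*_; _≤_)
open import Data.Nat.Logarithm using (⌈log₂_⌉)
open import Data.List using (List)
open import Data.Product using (∃; _,_)

open import Data.Nat using (zero; _∸_; _<_; _≡ᵇ_; _⊓_; _≟_; z≤n; s≤s)
open import Data.Nat.Properties
open import Data.Nat.Logarithm using (⌈log₂⌉-mono-≤; ⌈log₂2*n⌉≡1+⌈log₂n⌉; ⌈log₂2^n⌉≡n)
open import Data.Nat.Tactic.RingSolver using (solve-∀)
open import Data.Bool using (Bool; true; false; not; if_then_else_; _∧_; _∨_; T)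
open import Data.Bool.Properties using (∨-zeroʳ; T-≡; T?)
open import Data.Maybe using (just; nothing)
open import Data.Maybe.Properties using (just-injective)
open import Relation.Nullary using (yes; no)
open import Data.List using ([]; _∷_; _++_; length; filterᵇ; applyUpTo)
open import Data.List.Properties using (length-++; length-applyUpTo; length-filter; filter-none; filter-notAll)
open import Data.List.Membership.Propositional using (_∈_)
open import Data.List.Membership.Propositional.Properties using (∈-filter⁺; ∈-filter⁻; ∈-++⁻; ∈-upTo⁻; ∈-applyUpTo⁻)
open import Data.List.Relation.Unary.Any using (here; there) renaming (map to Any-map)
open import Data.List.Relation.Unary.All using (All; []; _∷_) renaming (lookup to All-lookup; tabulate to All-tabulate)
open import Data.List.Relation.Unary.AllPairs using (_∷_)
open import Data.List.Relation.Unary.Unique.Propositional using (Unique)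
open import Data.List.Relation.Unary.Unique.Propositional.Properties using (filter⁺; upTo⁺)
open import Data.Product using (_×_; proj₁; proj₂)
open import Data.Sum using (_⊎_; inj₁; inj₂)
open import Data.Empty using (⊥-elim)
open import Function using (_∘_; case_of_; Equivalence)
open import Relation.Binary.PropositionalEquality

nlog : ℕ → ℕ
nlog n = n * ⌈log₂ n ⌉

nlog-mono : ∀ {a b} → a ≤ b → nlog a ≤ nlog b
nlog-mono a≤b = *-mono-≤ a≤b (⌈log₂⌉-mono-≤ a≤b)

-- If a ≤ b then a + b ≥ 2a, so ⌈log₂ (a + b)⌉ ≥ 1 + ⌈log₂ a⌉ (for a > 0): merging the
-- smaller mass a into b raises the potential by at least a.
nlog-merge-≤ : ∀ a b → a ≤ b → nlog a + a + nlog b ≤ nlog (a + b)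
nlog-merge-≤ zero b _ = ≤-refl
nlog-merge-≤ a@(suc _) b a≤b = begin
    nlog a + a + nlog b          ≡⟨ cong (_+ nlog b) (trans (+-comm (nlog a) a) (sym (*-suc a _))) ⟩
    a * suc ⌈log₂ a ⌉ + nlog b   ≤⟨ +-mono-≤ (*-monoʳ-≤ a log-a<) (*-monoʳ-≤ b (⌈log₂⌉-mono-≤ (m≤n+m b a))) ⟩
    a * ⌈log₂ (a + b) ⌉ + b * ⌈log₂ (a + b) ⌉ ≡⟨ sym (*-distribʳ-+ _ a b) ⟩
    nlog (a + b)                 ∎
  where
  open ≤-Reasoning
  log-a< : suc ⌈log₂ a ⌉ ≤ ⌈log₂ (a + b) ⌉
  log-a< = subst (_≤ ⌈log₂ (a + b) ⌉) (⌈log₂2*n⌉≡1+⌈log₂n⌉ a)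
             (⌈log₂⌉-mono-≤ (subst (_≤ a + b) (cong (a +_) (sym (+-identityʳ a))) (+-monoʳ-≤ a a≤b)))

-- Merging masses a and b raises the potential by at least min(a, b); this pays for a
-- contraction, whose cost is bounded by the smaller of the two degrees.
nlog-merge : ∀ a b → nlog a + nlog b + a ⊓ b ≤ nlog (a + b)
nlog-merge a b with ≤-total a b
... | inj₁ a≤b = begin
    nlog a + nlog b + a ⊓ b ≡⟨ cong (nlog a + nlog b +_) (m≤n⇒m⊓n≡m a≤b) ⟩
    nlog a + nlog b + a     ≡⟨ +-assoc (nlog a) (nlog b) a ⟩
    nlog a + (nlog b + a)   ≡⟨ cong (nlog a +_) (+-comm (nlog b) a) ⟩
    nlog a + (a + nlog b)   ≡⟨ +-assoc (nlog a) a (nlog b) ⟨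
    nlog a + a + nlog b     ≤⟨ nlog-merge-≤ a b a≤b ⟩
    nlog (a + b)            ∎
  where open ≤-Reasoning
... | inj₂ b≤a = begin
    nlog a + nlog b + a ⊓ b ≡⟨ cong₂ _+_ (+-comm (nlog a) (nlog b)) (m≥n⇒m⊓n≡n b≤a) ⟩
    nlog b + nlog a + b     ≡⟨ +-assoc (nlog b) (nlog a) b ⟩
    nlog b + (nlog a + b)   ≡⟨ cong (nlog b +_) (+-comm (nlog a) b) ⟩
    nlog b + (b + nlog a)   ≡⟨ +-assoc (nlog b) b (nlog a) ⟨
    nlog b + b + nlog a     ≤⟨ nlog-merge-≤ b a b≤a ⟩
    nlog (b + a)            ≡⟨ cong nlog (+-comm b a) ⟩
    nlog (a + b)            ∎
  where open ≤-Reasoning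

nlog-superadditive : ∀ a b → nlog a + nlog b ≤ nlog (a + b)
nlog-superadditive a b = ≤-trans (m≤m+n _ (a ⊓ b)) (nlog-merge a b)

true≢false : true ≢ false
true≢false ()

≡ᵇ-sound : ∀ {m n} → (m ≡ᵇ n) ≡ true → m ≡ n
≡ᵇ-sound {m} {n} e = ≡ᵇ⇒≡ m n (Equivalence.from T-≡ e)

≡ᵇ-refl : ∀ n → (n ≡ᵇ n) ≡ true
≡ᵇ-refl n = Equivalence.to T-≡ (≡⇒≡ᵇ n n refl)

≡ᵇ-≢ : ∀ {m n} → m ≢ n → (m ≡ᵇ n) ≡ false
≡ᵇ-≢ {m} {n} m≢n with m ≡ᵇ n in e
... | true  = ⊥-elim (m≢n (≡ᵇ-sound e))
... | false = refl

memᵇ-sound : ∀ {w xs} → memᵇ w xs ≡ true → w ∈ xs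
memᵇ-sound {w} {x ∷ xs} e with x ≡ᵇ w in x≡w
... | true  = here (sym (≡ᵇ-sound x≡w))
... | false = there (memᵇ-sound e)

memᵇ-complete : ∀ {w xs} → w ∈ xs → memᵇ w xs ≡ true
memᵇ-complete {w} (here refl) rewrite ≡ᵇ-refl w = refl
memᵇ-complete {w} {x ∷ _} (there w∈) with x ≡ᵇ w
... | true  = refl
... | false = memᵇ-complete w∈

∈-filterᵇ⁻ : ∀ {p : ℕ → Bool} {xs x} → x ∈ filterᵇ p xs → x ∈ xs × p x ≡ true
∈-filterᵇ⁻ {p} x∈ with ∈-filter⁻ (T? ∘ p) x∈
... | x∈xs , px = x∈xs , Equivalence.to T-≡ px

∈-filterᵇ⁺ : ∀ {p : ℕ → Bool} {xs x} → x ∈ xs → p x ≡ true → x ∈ filterᵇ p xs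
∈-filterᵇ⁺ {p} x∈ px = ∈-filter⁺ (T? ∘ p) x∈ (Equivalence.from T-≡ px)

unique-filterᵇ : ∀ (p : ℕ → Bool) {xs} → Unique xs → Unique (filterᵇ p xs)
unique-filterᵇ p = filter⁺ (T? ∘ p)

count : (ℕ → Bool) → List ℕ → ℕ
count p xs = length (filterᵇ p xs)

count-true : ∀ xs → count (λ _ → true) xs ≡ length xs
count-true [] = refl
count-true (_ ∷ xs) = cong suc (count-true xs)

count-skip : ∀ p x xs → p x ≡ false → count p (x ∷ xs) ≡ count p xs
count-skip p x xs px rewrite px = refl

count-keep : ∀ p x xs → p x ≡ true → count p (x ∷ xs) ≡ suc (count p xs)
count-keep p x xs px rewrite px = refl

count-mono : ∀ p q xs → (∀ {x} → x ∈ xs → p x ≡ true → q x ≡ true) → count p xs ≤ count q xs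
count-mono p q [] _ = z≤n
count-mono p q (x ∷ xs) p⇒q with p x in px | q x in qx
... | true  | true  = s≤s (count-mono p q xs (p⇒q ∘ there))
... | true  | false = ⊥-elim (true≢false (trans (sym (p⇒q (here refl) px)) qx))
... | false | true  = m≤n⇒m≤1+n (count-mono p q xs (p⇒q ∘ there))
... | false | false = count-mono p q xs (p⇒q ∘ there)

count-∨ : ∀ (q r : ℕ → Bool) xs → count (λ x → q x ∨ r x) xs ≤ count q xs + count r xs
count-∨ q r [] = z≤n
count-∨ q r (x ∷ xs) with ih ← count-∨ q r xs | q x | r x
... | true  | true  = s≤s (≤-trans ih (+-monoʳ-≤ (count q xs) (n≤1+n _)))
... | true  | false = s≤s ih
... | false | true  = ≤-trans (s≤s ih) (≤-reflexive (sym (+-suc _ _)))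
... | false | false = ih

count-cover : ∀ (p q r : ℕ → Bool) xs → (∀ {x} → x ∈ xs → p x ≡ true → q x ≡ true ⊎ r x ≡ true) →
  count p xs ≤ count q xs + count r xs
count-cover p q r xs cover = ≤-trans (count-mono p (λ x → q x ∨ r x) xs q∨r) (count-∨ q r xs)
  where
  q∨r : ∀ {x} → x ∈ xs → p x ≡ true → (q x ∨ r x) ≡ true
  q∨r {x} x∈ px with cover x∈ px
  ... | inj₁ qx = cong (_∨ r x) qx
  ... | inj₂ rx = trans (cong (q x ∨_) rx) (∨-zeroʳ (q x))

count-partition : ∀ (p q : ℕ → Bool) xs → count p xs ≡ count (λ x → p x ∧ q x) xs + count (λ x → p x ∧ not (q x)) xs
count-partition p q [] = refl
count-partition p q (x ∷ xs) with p x | q x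
... | true  | true  = cong suc (count-partition p q xs)
... | true  | false = trans (cong suc (count-partition p q xs)) (sym (+-suc _ _))
... | false | _     = count-partition p q xs

count-filterᵇ-≤ : ∀ p q xs → count p (filterᵇ q xs) ≤ count p xs
count-filterᵇ-≤ p q [] = z≤n
count-filterᵇ-≤ p q (x ∷ xs) with q x | p x in px
... | true  | true  rewrite px = s≤s (count-filterᵇ-≤ p q xs)
... | true  | false rewrite px = count-filterᵇ-≤ p q xs
... | false | true  = m≤n⇒m≤1+n (count-filterᵇ-≤ p q xs)
... | false | false = count-filterᵇ-≤ p q xs

count-none : ∀ p xs → (∀ {x} → x ∈ xs → p x ≡ false) → count p xs ≡ 0
count-none p xs p≡false = cong length (filter-none (T? ∘ p) (All-tabulate λ x∈ → subst T (p≡false x∈)))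

without : ℕ → List ℕ → List ℕ
without v = filterᵇ (λ w → not (w ≡ᵇ v))

∈-without⁻ : ∀ {v x xs} → x ∈ without v xs → x ∈ xs × x ≢ v
∈-without⁻ {v} x∈ with ∈-filterᵇ⁻ x∈
... | x∈xs , x≠v = x∈xs , λ { refl → true≢false (trans (sym x≠v) (cong not (≡ᵇ-refl v))) }

∈-without⁺ : ∀ {v x xs} → x ∈ xs → x ≢ v → x ∈ without v xs
∈-without⁺ x∈ x≢v = ∈-filterᵇ⁺ x∈ (cong not (≡ᵇ-≢ x≢v))

count-without : ∀ p v xs → v ∈ xs → p v ≡ true → suc (count p (without v xs)) ≤ count p xs
count-without p v (x ∷ xs) (here refl) pv rewrite ≡ᵇ-refl v | pv = s≤s (count-filterᵇ-≤ p _ xs)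
count-without p v (x ∷ xs) (there v∈) pv with x ≡ᵇ v | p x in px
... | true  | true  = m≤n⇒m≤1+n (count-without p v xs v∈ pv)
... | true  | false = count-without p v xs v∈ pv
... | false | true  rewrite px = s≤s (count-without p v xs v∈ pv)
... | false | false rewrite px = count-without p v xs v∈ pv

unique-⊆-length : ∀ {xs ys} → Unique xs → (∀ {x} → x ∈ xs → x ∈ ys) → length xs ≤ length ys
unique-⊆-length {[]} _ _ = z≤n
unique-⊆-length {x ∷ xs} {ys} (x∉xs ∷ uniq) xs⊆ys =
  ≤-trans (s≤s (unique-⊆-length uniq xs⊆ys-x)) ys-x<ys
  where
  xs⊆ys-x : ∀ {y} → y ∈ xs → y ∈ without x ys
  xs⊆ys-x y∈ = ∈-without⁺ (xs⊆ys (there y∈)) (λ y≡x → All-lookup x∉xs y∈ (sym y≡x))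
  ys-x<ys : suc (length (without x ys)) ≤ length ys
  ys-x<ys = filter-notAll (T? ∘ λ w → not (w ≡ᵇ x)) ys
              (Any-map (λ { refl → subst (T ∘ not) (≡ᵇ-refl x) }) (xs⊆ys (here refl)))

sumOver : (ℕ → ℕ) → List ℕ → ℕ
sumOver g [] = 0
sumOver g (x ∷ xs) = g x + sumOver g xs

sum-ext : ∀ g h xs → (∀ {x} → x ∈ xs → g x ≡ h x) → sumOver g xs ≡ sumOver h xs
sum-ext g h [] _ = refl
sum-ext g h (x ∷ xs) g≗h = cong₂ _+_ (g≗h (here refl)) (sum-ext g h xs (g≗h ∘ there))

sum-zero : ∀ g xs → (∀ {x} → x ∈ xs → g x ≡ 0) → sumOver g xs ≡ 0
sum-zero g [] _ = refl
sum-zero g (x ∷ xs) g≡0 = cong₂ _+_ (g≡0 (here refl)) (sum-zero g xs (g≡0 ∘ there))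

sum-without-absent : ∀ g v xs → All (v ≢_) xs → sumOver g (without v xs) ≡ sumOver g xs
sum-without-absent g v [] [] = refl
sum-without-absent g v (x ∷ xs) (v≢x ∷ v∉xs) rewrite ≡ᵇ-≢ (v≢x ∘ sym) =
  cong (g x +_) (sum-without-absent g v xs v∉xs)

sum-without : ∀ g v xs → Unique xs → v ∈ xs → sumOver g (without v xs) + g v ≡ sumOver g xs
sum-without g v (x ∷ xs) (v∉xs ∷ _) (here refl) rewrite ≡ᵇ-refl v =
  trans (+-comm _ (g v)) (cong (g v +_) (sum-without-absent g v xs v∉xs))
sum-without g v (x ∷ xs) (x∉xs ∷ uniq) (there v∈) with x ≡ᵇ v in x≡v
... | true  = ⊥-elim (All-lookup x∉xs v∈ (≡ᵇ-sound x≡v))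
... | false = trans (+-assoc (g x) _ (g v)) (cong (g x +_) (sum-without g v xs uniq v∈))

sum-update : ∀ g h u xs → Unique xs → u ∈ xs → (∀ {x} → x ∈ xs → x ≢ u → h x ≡ g x) →
  sumOver h xs + g u ≡ sumOver g xs + h u
sum-update g h u xs uniq u∈ h≗g = begin
    sumOver h xs + g u                        ≡⟨ cong (_+ g u) (sum-without h u xs uniq u∈) ⟨
    sumOver h (without u xs) + h u + g u      ≡⟨ +-assoc _ (h u) (g u) ⟩
    sumOver h (without u xs) + (h u + g u)    ≡⟨ cong₂ _+_ (sum-ext h g _ h≗g-off-u) (+-comm (h u) (g u)) ⟩
    sumOver g (without u xs) + (g u + h u)    ≡⟨ +-assoc _ (g u) (h u) ⟨
    sumOver g (without u xs) + g u + h u      ≡⟨ cong (_+ h u) (sum-without g u xs uniq u∈) ⟩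
    sumOver g xs + h u                        ∎
  where
  open ≡-Reasoning
  h≗g-off-u : ∀ {x} → x ∈ without u xs → h x ≡ g x
  h≗g-off-u x∈ = let x∈xs , x≢u = ∈-without⁻ x∈ in h≗g x∈xs x≢u

isJust≡-sound : ∀ {mp x} → isJust≡ mp x ≡ true → mp ≡ just x
isJust≡-sound {just p} e = cong just (≡ᵇ-sound e)

isJust≡-complete : ∀ {mp x} → mp ≡ just x → isJust≡ mp x ≡ true
isJust≡-complete {x = x} refl = ≡ᵇ-refl x

degree-split : ∀ S x → d S x ≡ length (parentList (par S x)) + count (λ w → isJust≡ (par S w) x) (nodes S)
degree-split S x = length-++ (parentList (par S x))

-- Ranks strictly decrease towards the
-- root (so the parent structure is acyclic); fresh exceeds every node.
record Invariant (B : ℕ) (S : State) (mass rank : ℕ → ℕ) : Set where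
  field
    nodes-unique   : Unique (nodes S)
    below-fresh    : ∀ {x} → x ∈ nodes S → x < fresh S
    parent-present : ∀ {x p} → x ∈ nodes S → par S x ≡ just p → p ∈ nodes S
    rank-decreases : ∀ {x p} → x ∈ nodes S → par S x ≡ just p → rank p < rank x
    degree-bound   : ∀ {x} → x ∈ nodes S → d S x ≤ mass x + 2
    mass-bound     : sumOver mass (nodes S) ≤ B

-- Splits are paid from Φwhite, and contractions (which turn
-- the merged node black) from the growth of nlog under merging.
whiteWeight blackWeight : State → (ℕ → ℕ) → ℕ → ℕ
whiteWeight S mass x = if black S x then 0 else nlog (mass x)
blackWeight S mass x = if black S x then nlog (mass x) else 0

Φwhite Φblack : State → (ℕ → ℕ) → ℕ
Φwhite S mass = sumOver (whiteWeight S mass) (nodes S)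
Φblack S mass = sumOver (blackWeight S mass) (nodes S)

whiteWeight-≤ : ∀ S mass x → whiteWeight S mass x ≤ nlog (mass x)
whiteWeight-≤ S mass x with black S x
... | true  = z≤n
... | false = ≤-refl

blackWeight-≤ : ∀ S mass x → blackWeight S mass x ≤ nlog (mass x)
blackWeight-≤ S mass x with black S x
... | true  = ≤-refl
... | false = z≤n

weight-≤ : ∀ (g mass : ℕ → ℕ) xs → (∀ x → g x ≤ nlog (mass x)) → sumOver g xs ≤ nlog (sumOver mass xs)
weight-≤ g mass [] _ = z≤n
weight-≤ g mass (x ∷ xs) g≤ = ≤-trans (+-mono-≤ (g≤ x) (weight-≤ g mass xs g≤)) (nlog-superadditive (mass x) _)

Amortised : State → (ℕ → ℕ) → State → (ℕ → ℕ) → ℕ → ℕ → Set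
Amortised S mass S′ mass′ c t = c + Φwhite S′ mass′ + Φblack S mass ≤ t + Φwhite S mass + Φblack S′ mass′

telescope : ∀ c₁ c₂ t₁ t₂ W₀ W₁ W₂ K₀ K₁ K₂ →
  c₁ + W₁ + K₀ ≤ t₁ + W₀ + K₁ → c₂ + W₂ + K₁ ≤ t₂ + W₁ + K₂ →
  (c₁ + c₂) + W₂ + K₀ ≤ (t₁ + t₂) + W₀ + K₂
telescope c₁ c₂ t₁ t₂ W₀ W₁ W₂ K₀ K₁ K₂ step₁ step₂ = +-cancelʳ-≤ (W₁ + K₁) _ _ (begin
    (c₁ + c₂) + W₂ + K₀ + (W₁ + K₁)   ≡⟨ regroup₁ c₁ c₂ W₂ K₀ W₁ K₁ ⟩
    (c₁ + W₁ + K₀) + (c₂ + W₂ + K₁)   ≤⟨ +-mono-≤ step₁ step₂ ⟩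
    (t₁ + W₀ + K₁) + (t₂ + W₁ + K₂)   ≡⟨ regroup₂ t₁ t₂ W₀ W₁ K₁ K₂ ⟩
    (t₁ + t₂) + W₀ + K₂ + (W₁ + K₁)   ∎)
  where
  open ≤-Reasoning
  regroup₁ : ∀ c₁ c₂ W₂ K₀ W₁ K₁ → (c₁ + c₂) + W₂ + K₀ + (W₁ + K₁) ≡ (c₁ + W₁ + K₀) + (c₂ + W₂ + K₁)
  regroup₁ = solve-∀
  regroup₂ : ∀ t₁ t₂ W₀ W₁ K₁ K₂ → (t₁ + W₀ + K₁) + (t₂ + W₁ + K₂) ≡ (t₁ + t₂) + W₀ + K₂ + (W₁ + K₁)
  regroup₂ = solve-∀

amortised-local : ∀ c t W W′ K K′ ow nw ob nb →
  W′ + ow ≡ W + nw → K′ + ob ≡ K + nb → c + nw + ob ≤ t + ow + nb →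
  c + W′ + K ≤ t + W + K′
amortised-local c t W W′ K K′ ow nw ob nb ΔW ΔK local = +-cancelʳ-≤ (ow + nb) _ _ (begin
    c + W′ + K + (ow + nb)         ≡⟨ regroup₁ c W′ K ow nb ⟩
    c + (W′ + ow) + (K + nb)       ≡⟨ cong₂ (λ w k → c + w + k) ΔW (sym ΔK) ⟩
    c + (W + nw) + (K′ + ob)       ≡⟨ regroup₂ c W nw K′ ob ⟩
    (c + nw + ob) + (W + K′)       ≤⟨ +-monoˡ-≤ (W + K′) local ⟩
    (t + ow + nb) + (W + K′)       ≡⟨ regroup₃ t ow nb W K′ ⟩
    t + W + K′ + (ow + nb)         ∎)
  where
  open ≤-Reasoning
  regroup₁ : ∀ c W′ K ow nb → c + W′ + K + (ow + nb) ≡ c + (W′ + ow) + (K + nb)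
  regroup₁ = solve-∀
  regroup₂ : ∀ c W nw K′ ob → c + (W + nw) + (K′ + ob) ≡ (c + nw + ob) + (W + K′)
  regroup₂ = solve-∀
  regroup₃ : ∀ t ow nb W K′ → (t + ow + nb) + (W + K′) ≡ t + W + K′ + (ow + nb)
  regroup₃ = solve-∀

amortised-compose : ∀ {S₀ S₁ S₂ m₀ m₁ m₂ c₁ c₂ t₁ t₂} →
  Amortised S₀ m₀ S₁ m₁ c₁ t₁ → Amortised S₁ m₁ S₂ m₂ c₂ t₂ → Amortised S₀ m₀ S₂ m₂ (c₁ + c₂) (t₁ + t₂)
amortised-compose {S₀} {S₁} {S₂} {m₀} {m₁} {m₂} {c₁} {c₂} {t₁} {t₂} =
  telescope c₁ c₂ t₁ t₂ (Φwhite S₀ m₀) (Φwhite S₁ m₁) (Φwhite S₂ m₂) (Φblack S₀ m₀) (Φblack S₁ m₁) (Φblack S₂ m₂)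

record AmortisedBound (B : ℕ) (S : State) (mass : ℕ → ℕ) (S′ : State) (c t : ℕ) : Set where
  field
    mass′      : ℕ → ℕ
    rank′      : ℕ → ℕ
    invariant′ : Invariant B S′ mass′ rank′
    amortised  : Amortised S mass S′ mass′ c t

module Contraction {B S v u} {mass rank : ℕ → ℕ}
  (v∈ : v ∈ nodes S) (u∈ : u ∈ nodes S) (v→u : par S v ≡ just u) (inv : Invariant B S mass rank) where

  open Invariant inv

  S′ : State
  S′ = contractState S v u

  Ns Ns′ : List ℕ
  Ns  = nodes S
  Ns′ = nodes S′

  childOf childOf′ : ℕ → ℕ → Bool
  childOf  x w = isJust≡ (par S w) x
  childOf′ x w = isJust≡ (par S′ w) x

  u≢v : u ≢ v
  u≢v refl = <-irrefl refl (rank-decreases v∈ v→u)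

  mass′ : ℕ → ℕ
  mass′ x = if x ≡ᵇ u then mass u + mass v else mass x

  mass′-u : mass′ u ≡ mass u + mass v
  mass′-u rewrite ≡ᵇ-refl u = refl

  mass′-other : ∀ {x} → x ≢ u → mass′ x ≡ mass x
  mass′-other x≢u rewrite ≡ᵇ-≢ x≢u = refl

  black′-u : black S′ u ≡ true
  black′-u rewrite ≡ᵇ-refl u = refl

  black′-other : ∀ {x} → x ≢ u → black S′ x ≡ black S x
  black′-other x≢u rewrite ≡ᵇ-≢ x≢u = refl

  data ParentCase (x : ℕ) : Set where
    reattached : par S x ≡ just v → par S′ x ≡ just u → ParentCase x
    unchanged  : isJust≡ (par S x) v ≡ false → par S′ x ≡ par S x → ParentCase x

  parentCase : ∀ x → ParentCase x
  parentCase x with isJust≡ (par S x) v in child-of-v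
  ... | true  = reattached (isJust≡-sound child-of-v) (cong (λ b → if b then just u else par S x) child-of-v)
  ... | false = unchanged child-of-v (cong (λ b → if b then just u else par S x) child-of-v)

  parents-same : ∀ x → length (parentList (par S′ x)) ≡ length (parentList (par S x))
  parents-same x with parentCase x
  ... | reattached p≡v p′≡u = trans (cong (length ∘ parentList) p′≡u) (cong (length ∘ parentList) (sym p≡v))
  ... | unchanged _ p′≡p    = cong (length ∘ parentList) p′≡p

  degree-other : ∀ {x} → x ≢ u → d S′ x ≤ d S x
  degree-other {x} x≢u = begin
      d S′ x                                                      ≡⟨ degree-split S′ x ⟩
      length (parentList (par S′ x)) + count (childOf′ x) Ns′    ≤⟨ +-mono-≤ (≤-reflexive (parents-same x)) fewer-children ⟩
      length (parentList (par S x)) + count (childOf x) Ns       ≡⟨ degree-split S x ⟨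
      d S x                                                       ∎
    where
    open ≤-Reasoning
    still-child : ∀ {w} → w ∈ Ns → childOf′ x w ≡ true → childOf x w ≡ true
    still-child {w} _ child′ with parentCase w
    ... | reattached _ p′≡u = ⊥-elim (x≢u (just-injective (trans (sym (isJust≡-sound child′)) p′≡u)))
    ... | unchanged _ p′≡p  = trans (cong (λ mp → isJust≡ mp x) (sym p′≡p)) child′
    fewer-children : count (childOf′ x) Ns′ ≤ count (childOf x) Ns
    fewer-children = ≤-trans (count-filterᵇ-≤ _ _ Ns) (count-mono _ _ Ns still-child)

  children-merged : suc (count (childOf′ u) Ns′) ≤ count (childOf v) Ns + count (childOf u) Ns
  children-merged = begin
      suc (count (childOf′ u) Ns′)                          ≤⟨ s≤s (count-cover _ (childOf v) (childOf u) Ns′ old-child) ⟩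
      suc (count (childOf v) Ns′ + count (childOf u) Ns′)   ≡⟨ +-suc _ _ ⟨
      count (childOf v) Ns′ + suc (count (childOf u) Ns′)   ≤⟨ +-mono-≤ (count-filterᵇ-≤ _ _ Ns) (count-without _ v Ns v∈ (isJust≡-complete v→u)) ⟩
      count (childOf v) Ns + count (childOf u) Ns           ∎
    where
    open ≤-Reasoning
    old-child : ∀ {w} → w ∈ Ns′ → childOf′ u w ≡ true → childOf v w ≡ true ⊎ childOf u w ≡ true
    old-child {w} _ child′ with parentCase w
    ... | reattached p≡v _ = inj₁ (isJust≡-complete p≡v)
    ... | unchanged _ p′≡p = inj₂ (trans (cong (λ mp → isJust≡ mp u) (sym p′≡p)) child′)

  degree-merged : d S′ u + 2 ≤ d S u + d S v
  degree-merged = begin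
      d S′ u + 2                      ≡⟨ cong (_+ 2) (trans (degree-split S′ u) (cong (_+ count (childOf′ u) Ns′) (parents-same u))) ⟩
      Pu + count (childOf′ u) Ns′ + 2 ≡⟨ regroup₁ Pu (count (childOf′ u) Ns′) ⟩
      Pu + suc (count (childOf′ u) Ns′) + 1 ≤⟨ +-monoˡ-≤ 1 (+-monoʳ-≤ Pu children-merged) ⟩
      Pu + (Cv + Cu) + 1              ≡⟨ regroup₂ Pu Cv Cu ⟩
      (Pu + Cu) + (1 + Cv)            ≡⟨ cong₂ _+_ (degree-split S u) degree-v ⟨
      d S u + d S v                   ∎
    where
    open ≤-Reasoning
    Pu = length (parentList (par S u))
    Cu = count (childOf u) Ns
    Cv = count (childOf v) Ns
    degree-v : d S v ≡ 1 + Cv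
    degree-v = trans (degree-split S v) (cong (λ mp → length (parentList mp) + Cv) v→u)
    regroup₁ : ∀ a c → a + c + 2 ≡ a + suc c + 1
    regroup₁ = solve-∀
    regroup₂ : ∀ a b c → a + (b + c) + 1 ≡ (a + c) + (1 + b)
    regroup₂ = solve-∀

  sum-contracted : ∀ g h → (∀ {x} → x ≢ u → h x ≡ g x) → sumOver h Ns′ + (g u + g v) ≡ sumOver g Ns + h u
  sum-contracted g h h≗g = begin
      sumOver h Ns′ + (g u + g v)   ≡⟨ cong (λ z → sumOver h Ns′ + (g u + z)) (h≗g (u≢v ∘ sym)) ⟨
      sumOver h Ns′ + (g u + h v)   ≡⟨ regroup (sumOver h Ns′) (g u) (h v) ⟩
      sumOver h Ns′ + h v + g u     ≡⟨ cong (_+ g u) (sum-without h v Ns nodes-unique v∈) ⟩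
      sumOver h Ns + g u            ≡⟨ sum-update g h u Ns nodes-unique u∈ (λ _ → h≗g) ⟩
      sumOver g Ns + h u            ∎
    where
    open ≡-Reasoning
    regroup : ∀ a b c → a + (b + c) ≡ a + c + b
    regroup a b c = trans (cong (a +_) (+-comm b c)) (sym (+-assoc a c b))

  -- Merging pays for the cost min(d u, d v) ≤ min(mass u, mass v) + 2.
  merge-pays : d S u ⊓ d S v + (blackWeight S mass u + blackWeight S mass v) ≤ 2 + nlog (mass u + mass v)
  merge-pays = begin
      d S u ⊓ d S v + (blackWeight S mass u + blackWeight S mass v)
        ≤⟨ +-mono-≤ (⊓-mono-≤ (degree-bound u∈) (degree-bound v∈)) (+-mono-≤ (blackWeight-≤ S mass u) (blackWeight-≤ S mass v)) ⟩
      (mass u + 2) ⊓ (mass v + 2) + (nlog (mass u) + nlog (mass v))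
        ≡⟨ cong (_+ (nlog (mass u) + nlog (mass v))) (+-distribʳ-⊓ 2 (mass u) (mass v)) ⟨
      (mass u ⊓ mass v + 2) + (nlog (mass u) + nlog (mass v))
        ≡⟨ regroup (mass u ⊓ mass v) (nlog (mass u)) (nlog (mass v)) ⟩
      2 + (nlog (mass u) + nlog (mass v) + mass u ⊓ mass v)
        ≤⟨ +-monoʳ-≤ 2 (nlog-merge (mass u) (mass v)) ⟩
      2 + nlog (mass u + mass v) ∎
    where
    open ≤-Reasoning
    regroup : ∀ m a b → (m + 2) + (a + b) ≡ 2 + (a + b + m)
    regroup = solve-∀

  amortised : Amortised S mass S′ mass′ (d S u ⊓ d S v) 2
  amortised = amortised-local (d S u ⊓ d S v) 2 (Φwhite S mass) (Φwhite S′ mass′) (Φblack S mass) (Φblack S′ mass′)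
      (ww u + ww v) 0 (bw u + bw v) (nlog (mass u + mass v))
      (trans (sum-contracted ww ww′ white-unchanged) (cong (Φwhite S mass +_) white′-u))
      (trans (sum-contracted bw bw′ black-unchanged) (cong (Φblack S mass +_) black-weight′-u))
      (≤-trans (≤-reflexive (cong (_+ (bw u + bw v)) (+-identityʳ (d S u ⊓ d S v))))
               (≤-trans merge-pays (+-monoˡ-≤ (nlog (mass u + mass v)) (m≤m+n 2 (ww u + ww v)))))
    where
    ww = whiteWeight S mass
    bw = blackWeight S mass
    ww′ = whiteWeight S′ mass′
    bw′ = blackWeight S′ mass′
    white-unchanged : ∀ {x} → x ≢ u → ww′ x ≡ ww x
    white-unchanged x≢u = cong₂ (λ b n → if b then 0 else nlog n) (black′-other x≢u) (mass′-other x≢u)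
    black-unchanged : ∀ {x} → x ≢ u → bw′ x ≡ bw x
    black-unchanged x≢u = cong₂ (λ b n → if b then nlog n else 0) (black′-other x≢u) (mass′-other x≢u)
    white′-u : ww′ u ≡ 0
    white′-u = cong (λ b → if b then 0 else nlog (mass′ u)) black′-u
    black-weight′-u : bw′ u ≡ nlog (mass u + mass v)
    black-weight′-u = cong₂ (λ b n → if b then nlog n else 0) black′-u mass′-u

  remaining : ∀ {x} → x ∈ Ns′ → x ∈ Ns
  remaining = proj₁ ∘ ∈-without⁻

  -- The new parent of a remaining node is either u (for former children of v) or its old
  -- parent, which is not v; in both cases it remains and has smaller rank.
  parent-present′ : ∀ {x p} → x ∈ Ns′ → par S′ x ≡ just p → p ∈ Ns′
  parent-present′ {x} x∈ p′≡p with parentCase x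
  ... | reattached _ p′≡u rewrite just-injective (trans (sym p′≡p) p′≡u) = ∈-without⁺ u∈ u≢v
  ... | unchanged not-v p′≡old = ∈-without⁺ (parent-present (remaining x∈) old≡p) λ { refl → true≢false (trans (sym (isJust≡-complete old≡p)) not-v) }
    where old≡p = trans (sym p′≡old) p′≡p

  rank-decreases′ : ∀ {x p} → x ∈ Ns′ → par S′ x ≡ just p → rank p < rank x
  rank-decreases′ {x} x∈ p′≡p with parentCase x
  ... | reattached x→v p′≡u rewrite just-injective (trans (sym p′≡p) p′≡u) =
    <-trans (rank-decreases v∈ v→u) (rank-decreases (remaining x∈) x→v)
  ... | unchanged _ p′≡old = rank-decreases (remaining x∈) (trans (sym p′≡old) p′≡p)

  degree-bound′ : ∀ {x} → x ∈ Ns′ → d S′ x ≤ mass′ x + 2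
  degree-bound′ {x} x∈ with x ≟ u
  ... | yes refl = subst (d S′ u ≤_) (cong (_+ 2) (sym mass′-u)) (+-cancelʳ-≤ 2 _ _ (begin
      d S′ u + 2                  ≤⟨ degree-merged ⟩
      d S u + d S v               ≤⟨ +-mono-≤ (degree-bound u∈) (degree-bound v∈) ⟩
      (mass u + 2) + (mass v + 2) ≡⟨ regroup (mass u) (mass v) ⟩
      mass u + mass v + 2 + 2     ∎))
    where
    open ≤-Reasoning
    regroup : ∀ a b → (a + 2) + (b + 2) ≡ a + b + 2 + 2
    regroup = solve-∀
  ... | no x≢u = subst (d S′ x ≤_) (cong (_+ 2) (sym (mass′-other x≢u)))
                   (≤-trans (degree-other x≢u) (degree-bound (remaining x∈)))

  mass-preserved : sumOver mass′ Ns′ ≡ sumOver mass Ns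
  mass-preserved = +-cancelʳ-≡ (mass u + mass v) _ _
    (trans (sum-contracted mass mass′ mass′-other) (cong (sumOver mass Ns +_) mass′-u))

  stepBound : AmortisedBound B S mass S′ (d S u ⊓ d S v) 2
  stepBound = record
    { mass′ = mass′
    ; rank′ = rank
    ; invariant′ = record
      { nodes-unique   = unique-filterᵇ _ nodes-unique
      ; below-fresh    = below-fresh ∘ remaining
      ; parent-present = parent-present′
      ; rank-decreases = rank-decreases′
      ; degree-bound   = degree-bound′
      ; mass-bound     = subst (_≤ B) (sym mass-preserved) mass-bound
      }
    ; amortised = amortised
    }

record MovedFacts (S : State) (u : ℕ) (M L : List ℕ) : Set where
  field
    moved-unique : Unique L
    moved-child  : ∀ {w} → w ∈ L → w ∈ nodes S × par S w ≡ just u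
    M≤moved      : length M ≤ length L
    moved+M≤d    : length L + length M ≤ d S u

module MovedSet {B S u M} {mass rank : ℕ → ℕ} (u∈ : u ∈ nodes S)
  (M-unique : Unique M) (M⊆N : All (λ w → w ∈ N S u) M) (2M≤d : 2 * length M ≤ d S u)
  (inv : Invariant B S mass rank) where

  open Invariant inv

  inM notInM : ℕ → Bool
  inM w = memᵇ w M
  notInM w = not (memᵇ w M)

  child-of-u : ∀ {w} → w ∈ children S u → w ∈ nodes S × par S w ≡ just u
  child-of-u w∈ with ∈-filterᵇ⁻ w∈
  ... | w∈S , w→u = w∈S , isJust≡-sound w→u

  neighbour : ∀ {w} → w ∈ N S u → par S u ≡ just w ⊎ (w ∈ nodes S × par S w ≡ just u)
  neighbour w∈ with ∈-++⁻ (parentList (par S u)) w∈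
  ... | inj₂ w∈ch = inj₂ (child-of-u w∈ch)
  ... | inj₁ w∈pl with par S u
  ...   | just p with w∈pl
  ...     | here refl = inj₁ refl

  keep-parent : (∀ {p} → par S u ≡ just p → inM p ≡ false) → MovedFacts S u M M
  keep-parent parent∉M = record
    { moved-unique = M-unique
    ; moved-child  = child
    ; M≤moved      = ≤-refl
    ; moved+M≤d    = subst (_≤ d S u) (cong (length M +_) (+-identityʳ (length M))) 2M≤d
    }
    where
    child : ∀ {w} → w ∈ M → w ∈ nodes S × par S w ≡ just u
    child w∈M with neighbour (All-lookup M⊆N w∈M)
    ... | inj₁ u→w = ⊥-elim (true≢false (trans (sym (memᵇ-complete w∈M)) (parent∉M u→w)))
    ... | inj₂ w-child = w-child

  move-parent : ∀ {p} → par S u ≡ just p → inM p ≡ true → MovedFacts S u M (filterᵇ notInM (N S u))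
  move-parent {p} u→p p∈M = record
    { moved-unique = unique-filterᵇ notInM N-unique
    ; moved-child  = child
    ; M≤moved      = M≤complement
    ; moved+M≤d    = ≤-reflexive complement+M
    }
    where
    -- p is not also a child of u, since ranks decrease towards the root.
    N-unique : Unique (N S u)
    N-unique = subst Unique (cong (λ mp → parentList mp ++ children S u) (sym u→p))
      (All-tabulate (λ { w∈ refl → let p∈ , p→u = child-of-u w∈ in
                          <-asym (rank-decreases u∈ u→p) (rank-decreases p∈ p→u) })
       ∷ unique-filterᵇ _ nodes-unique)
    child : ∀ {w} → w ∈ filterᵇ notInM (N S u) → w ∈ nodes S × par S w ≡ just u
    child w∈ with ∈-filterᵇ⁻ w∈
    ... | w∈N , w∉M with neighbour w∈N
    ...   | inj₂ w-child = w-child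
    ...   | inj₁ u→w with just-injective (trans (sym u→p) u→w)
    ...     | refl = ⊥-elim (true≢false (trans (sym w∉M) (cong not p∈M)))
    -- M ⊆ N(u) and both are duplicate-free, so exactly |M| neighbours lie in M.
    M-count : count inM (N S u) ≡ length M
    M-count = ≤-antisym
      (unique-⊆-length {ys = M} (unique-filterᵇ inM N-unique) (λ w∈ → memᵇ-sound (proj₂ (∈-filterᵇ⁻ {inM} {N S u} w∈))))
      (unique-⊆-length {ys = filterᵇ inM (N S u)} M-unique (λ w∈M → ∈-filterᵇ⁺ (All-lookup M⊆N w∈M) (memᵇ-complete w∈M)))
    complement+M : count notInM (N S u) + length M ≡ d S u
    complement+M = begin
      count notInM (N S u) + length M           ≡⟨ +-comm _ (length M) ⟩
      length M + count notInM (N S u)           ≡⟨ cong (_+ count notInM (N S u)) M-count ⟨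
      count inM (N S u) + count notInM (N S u)  ≡⟨ count-partition (λ _ → true) inM (N S u) ⟨
      count (λ _ → true) (N S u)                ≡⟨ count-true (N S u) ⟩
      d S u                                     ∎
      where open ≡-Reasoning
    M≤complement : length M ≤ count notInM (N S u)
    M≤complement = +-cancelʳ-≤ (length M) _ _ (begin
      length M + length M               ≡⟨ cong (length M +_) (+-identityʳ (length M)) ⟨
      2 * length M                      ≤⟨ 2M≤d ⟩
      d S u                             ≡⟨ complement+M ⟨
      count notInM (N S u) + length M   ∎)
      where open ≤-Reasoning

  root-test : par S u ≡ nothing → rootOrParentNotIn S u M ≡ true
  root-test u→ rewrite u→ = refl

  parent-test : ∀ {p} → par S u ≡ just p → rootOrParentNotIn S u M ≡ notInM p
  parent-test u→ rewrite u→ = refl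

  moved≡ : ∀ {b} → rootOrParentNotIn S u M ≡ b → M′ S u M ≡ (if b then M else filterᵇ notInM (N S u))
  moved≡ = cong (λ b → if b then M else filterᵇ notInM (N S u))

  moved-facts : MovedFacts S u M (M′ S u M)
  moved-facts = by-parent (par S u) refl
    where
    by-parent : ∀ mp → par S u ≡ mp → MovedFacts S u M (M′ S u M)
    by-parent nothing u→ = subst (MovedFacts S u M) (sym (moved≡ (root-test u→)))
                             (keep-parent λ u→p → case trans (sym u→) u→p of λ ())
    by-parent (just p) u→ with inM p in p-in
    ... | false = subst (MovedFacts S u M) (sym (moved≡ (trans (parent-test u→) (cong not p-in))))
                    (keep-parent (λ u→q → subst (λ q → inM q ≡ false) (just-injective (trans (sym u→) u→q)) p-in))
    ... | true  = subst (MovedFacts S u M) (sym (moved≡ (trans (parent-test u→) (cong not p-in)))) (move-parent u→ p-in)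

-- split(u, M): a new white node v = fresh S becomes a child of u and adopts M′.
-- Of the mass of u, |M′| - 1 moves to v and the rest stays with u.
module Splitting {B S u M} {mass rank : ℕ → ℕ} (u∈ : u ∈ nodes S) (u-white : black S u ≡ false)
  (M-unique : Unique M) (M⊆N : All (λ w → w ∈ N S u) M) (M≥1 : 1 ≤ length M) (2M≤d : 2 * length M ≤ d S u)
  (inv : Invariant B S mass rank) where

  open Invariant inv
  open MovedFacts (MovedSet.moved-facts u∈ M-unique M⊆N 2M≤d inv)

  S′ : State
  S′ = splitState S u M

  v : ℕ
  v = fresh S

  Ns moved : List ℕ
  Ns = nodes S
  moved = M′ S u M

  k : ℕ
  k = length moved

  isMoved : ℕ → Bool
  isMoved w = memᵇ w moved

  childOf childOf′ : ℕ → ℕ → Bool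
  childOf  x w = isJust≡ (par S w) x
  childOf′ x w = isJust≡ (par S′ w) x

  old≢v : ∀ {x} → x ∈ Ns → x ≢ v
  old≢v x∈ refl = <-irrefl refl (below-fresh x∈)

  u≢v : u ≢ v
  u≢v = old≢v u∈

  par′-v : par S′ v ≡ just u
  par′-v = cong (λ b → if b then just u else (if isMoved v then just v else par S v)) (≡ᵇ-refl v)

  data ParentCase (x : ℕ) : Set where
    moved-down : x ∈ moved → par S′ x ≡ just v → ParentCase x
    unchanged  : isMoved x ≡ false → par S′ x ≡ par S x → ParentCase x

  par′-old : ∀ {x} → x ∈ Ns → par S′ x ≡ (if isMoved x then just v else par S x)
  par′-old {x} x∈ = cong (λ b → if b then just u else (if isMoved x then just v else par S x)) (≡ᵇ-≢ (old≢v x∈))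

  parentCase : ∀ {x} → x ∈ Ns → ParentCase x
  parentCase {x} x∈ with isMoved x in x-moved
  ... | true  = moved-down (memᵇ-sound x-moved) (trans (par′-old x∈) (cong (λ b → if b then just v else par S x) x-moved))
  ... | false = unchanged x-moved (trans (par′-old x∈) (cong (λ b → if b then just v else par S x) x-moved))

  parents-same : ∀ {x} → x ∈ Ns → length (parentList (par S′ x)) ≡ length (parentList (par S x))
  parents-same x∈ with parentCase x∈
  ... | moved-down x∈M′ x→v = trans (cong (length ∘ parentList) x→v) (cong (length ∘ parentList) (sym (proj₂ (moved-child x∈M′))))
  ... | unchanged _ p′≡p    = cong (length ∘ parentList) p′≡p

  moved-count : count isMoved Ns ≤ k
  moved-count = unique-⊆-length {ys = moved} (unique-filterᵇ isMoved nodes-unique)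
                  (λ w∈ → memᵇ-sound (proj₂ (∈-filterᵇ⁻ {isMoved} {Ns} w∈)))

  -- The new node has parent u and the children M′.
  degree-new : d S′ v ≤ suc k
  degree-new = begin
      d S′ v                                                   ≡⟨ degree-split S′ v ⟩
      length (parentList (par S′ v)) + count (childOf′ v) (v ∷ Ns) ≡⟨ cong₂ _+_ (cong (length ∘ parentList) par′-v) (count-skip (childOf′ v) v Ns v-not-own-child) ⟩
      suc (count (childOf′ v) Ns)                              ≤⟨ s≤s (count-mono _ isMoved Ns child-is-moved) ⟩
      suc (count isMoved Ns)                                   ≤⟨ s≤s moved-count ⟩
      suc k                                                    ∎
    where
    open ≤-Reasoning
    v-not-own-child : childOf′ v v ≡ false
    v-not-own-child = trans (cong (λ mp → isJust≡ mp v) par′-v) (≡ᵇ-≢ u≢v)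
    child-is-moved : ∀ {w} → w ∈ Ns → childOf′ v w ≡ true → isMoved w ≡ true
    child-is-moved w∈ child′ with parentCase w∈
    ... | moved-down w∈M′ _ = memᵇ-complete w∈M′
    ... | unchanged _ p′≡p  = ⊥-elim (old≢v (parent-present w∈ (trans (sym p′≡p) (isJust≡-sound child′))) refl)

  -- u keeps its unmoved children and gains v, so its degree drops by k - 1.
  degree-split-node : d S′ u + k ≤ d S u + 1
  degree-split-node = begin
      d S′ u + k                              ≡⟨ cong (_+ k) (degree-split S′ u) ⟩
      P′ + count (childOf′ u) (v ∷ Ns) + k    ≡⟨ cong (λ z → z + k) (cong₂ _+_ (parents-same u∈) (count-keep (childOf′ u) v Ns (isJust≡-complete par′-v))) ⟩
      P + suc (count (childOf′ u) Ns) + k     ≤⟨ +-mono-≤ (+-monoʳ-≤ P (s≤s (count-mono _ unmovedChild Ns stays))) moved-are-children ⟩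
      P + suc Cout + Cin                      ≡⟨ regroup P Cout Cin ⟩
      P + (Cin + Cout) + 1                    ≡⟨ cong (λ z → P + z + 1) (count-partition (childOf u) isMoved Ns) ⟨
      P + count (childOf u) Ns + 1            ≡⟨ cong (_+ 1) (degree-split S u) ⟨
      d S u + 1                               ∎
    where
    open ≤-Reasoning
    P′ = length (parentList (par S′ u))
    P = length (parentList (par S u))
    unmovedChild movedChild : ℕ → Bool
    unmovedChild w = childOf u w ∧ not (isMoved w)
    movedChild w = childOf u w ∧ isMoved w
    Cout = count unmovedChild Ns
    Cin = count movedChild Ns
    stays : ∀ {w} → w ∈ Ns → childOf′ u w ≡ true → unmovedChild w ≡ true
    stays w∈ child′ with parentCase w∈
    ... | moved-down _ w→v = ⊥-elim (u≢v (just-injective (trans (sym (isJust≡-sound child′)) w→v)))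
    ... | unchanged not-moved p′≡p = cong₂ (λ c m → c ∧ not m) (trans (cong (λ mp → isJust≡ mp u) (sym p′≡p)) child′) not-moved
    moved-are-children : k ≤ Cin
    moved-are-children = unique-⊆-length {ys = filterᵇ movedChild Ns} moved-unique λ w∈M′ →
      let w∈ , w→u = moved-child w∈M′ in
      ∈-filterᵇ⁺ w∈ (cong₂ _∧_ (isJust≡-complete w→u) (memᵇ-complete w∈M′))
    regroup : ∀ a b c → a + suc b + c ≡ a + (c + b) + 1
    regroup = solve-∀

  -- Any other old node keeps exactly its children, minus those moved below v.
  degree-other : ∀ {x} → x ∈ Ns → x ≢ u → d S′ x ≤ d S x
  degree-other {x} x∈ x≢u = begin
      d S′ x                                                       ≡⟨ degree-split S′ x ⟩
      length (parentList (par S′ x)) + count (childOf′ x) (v ∷ Ns) ≡⟨ cong₂ _+_ (parents-same x∈) (count-skip (childOf′ x) v Ns v-not-child) ⟩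
      length (parentList (par S x)) + count (childOf′ x) Ns        ≤⟨ +-monoʳ-≤ _ (count-mono _ _ Ns still-child) ⟩
      length (parentList (par S x)) + count (childOf x) Ns         ≡⟨ degree-split S x ⟨
      d S x                                                        ∎
    where
    open ≤-Reasoning
    v-not-child : childOf′ x v ≡ false
    v-not-child = trans (cong (λ mp → isJust≡ mp x) par′-v) (≡ᵇ-≢ (x≢u ∘ sym))
    still-child : ∀ {w} → w ∈ Ns → childOf′ x w ≡ true → childOf x w ≡ true
    still-child w∈ child′ with parentCase w∈
    ... | moved-down _ w→v = ⊥-elim (old≢v x∈ (sym (just-injective (trans (sym w→v) (isJust≡-sound child′)))))
    ... | unchanged _ p′≡p = trans (cong (λ mp → isJust≡ mp x) (sym p′≡p)) child′

  j a : ℕ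
  j = k ∸ 1
  a = mass u ∸ j

  k≡1+j : k ≡ suc j
  k≡1+j = trans (sym (m∸n+n≡m (≤-trans M≥1 M≤moved))) (+-comm j 1)

  -- k + 1 ≤ k + |M| ≤ d(u) ≤ mass u + 2, so u can afford to hand mass j = k - 1 to v.
  j≤mass-u : j ≤ mass u
  j≤mass-u = ≤-pred (+-cancelʳ-≤ 1 _ _ (begin
      suc j + 1        ≡⟨ cong (_+ 1) k≡1+j ⟨
      k + 1            ≤⟨ +-monoʳ-≤ k M≥1 ⟩
      k + length M     ≤⟨ moved+M≤d ⟩
      d S u            ≤⟨ degree-bound u∈ ⟩
      mass u + 2       ≡⟨ +-suc (mass u) 1 ⟩
      suc (mass u) + 1 ∎))
    where open ≤-Reasoning

  a+j≡mass-u : a + j ≡ mass u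
  a+j≡mass-u = m∸n+n≡m j≤mass-u

  mass′ : ℕ → ℕ
  mass′ w = if w ≡ᵇ v then j else (if w ≡ᵇ u then a else mass w)

  mass′-v : mass′ v ≡ j
  mass′-v rewrite ≡ᵇ-refl v = refl

  mass′-u : mass′ u ≡ a
  mass′-u rewrite ≡ᵇ-≢ u≢v | ≡ᵇ-refl u = refl

  mass′-other : ∀ {x} → x ∈ Ns → x ≢ u → mass′ x ≡ mass x
  mass′-other x∈ x≢u rewrite ≡ᵇ-≢ (old≢v x∈) | ≡ᵇ-≢ x≢u = refl

  black′-v : black S′ v ≡ false
  black′-v rewrite ≡ᵇ-refl v = refl

  black′-old : ∀ {x} → x ∈ Ns → black S′ x ≡ black S x
  black′-old x∈ rewrite ≡ᵇ-≢ (old≢v x∈) = refl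

  -- Ranks are doubled so that v fits strictly between u and the moved children.
  rank′ : ℕ → ℕ
  rank′ w = if w ≡ᵇ v then suc (rank u + rank u) else rank w + rank w

  rank′-v : rank′ v ≡ suc (rank u + rank u)
  rank′-v rewrite ≡ᵇ-refl v = refl

  rank′-old : ∀ {x} → x ∈ Ns → rank′ x ≡ rank x + rank x
  rank′-old x∈ rewrite ≡ᵇ-≢ (old≢v x∈) = refl

  parent-present′ : ∀ {x p} → x ∈ nodes S′ → par S′ x ≡ just p → p ∈ nodes S′
  parent-present′ (here refl) v→p rewrite sym (just-injective (trans (sym par′-v) v→p)) = there u∈
  parent-present′ (there x∈) x→p with parentCase x∈
  ... | moved-down _ x→v rewrite sym (just-injective (trans (sym x→v) x→p)) = here refl
  ... | unchanged _ p′≡p = there (parent-present x∈ (trans (sym p′≡p) x→p))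

  rank-decreases′ : ∀ {x p} → x ∈ nodes S′ → par S′ x ≡ just p → rank′ p < rank′ x
  rank-decreases′ (here refl) v→p rewrite sym (just-injective (trans (sym par′-v) v→p)) =
    subst₂ _<_ (sym (rank′-old u∈)) (sym rank′-v) (n<1+n _)
  rank-decreases′ {x} (there x∈) x→p with parentCase x∈
  ... | moved-down x∈M′ x→v rewrite sym (just-injective (trans (sym x→v) x→p)) =
    subst₂ _<_ (sym rank′-v) (sym (rank′-old x∈))
      (subst (_≤ rank x + rank x) (cong suc (+-suc (rank u) (rank u))) (+-mono-≤ u<x u<x))
    where u<x = rank-decreases x∈ (proj₂ (moved-child x∈M′))
  ... | unchanged _ p′≡p =
    subst₂ _<_ (sym (rank′-old (parent-present x∈ x→p-old))) (sym (rank′-old x∈))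
      (+-mono-< (rank-decreases x∈ x→p-old) (rank-decreases x∈ x→p-old))
    where x→p-old = trans (sym p′≡p) x→p

  degree-bound′ : ∀ {x} → x ∈ nodes S′ → d S′ x ≤ mass′ x + 2
  degree-bound′ (here refl) = subst (d S′ v ≤_) (trans (cong suc k≡1+j) (trans (+-comm 2 j) (cong (_+ 2) (sym mass′-v)))) degree-new
  degree-bound′ {x} (there x∈) with x ≟ u
  ... | yes refl = subst (d S′ u ≤_) (cong (_+ 2) (sym mass′-u)) (+-cancelʳ-≤ k _ _ (begin
      d S′ u + k       ≤⟨ degree-split-node ⟩
      d S u + 1        ≤⟨ +-monoˡ-≤ 1 (degree-bound u∈) ⟩
      mass u + 2 + 1   ≡⟨ cong (λ m → m + 2 + 1) a+j≡mass-u ⟨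
      a + j + 2 + 1    ≡⟨ regroup a j ⟩
      a + 2 + suc j    ≡⟨ cong (a + 2 +_) k≡1+j ⟨
      a + 2 + k        ∎))
    where
    open ≤-Reasoning
    regroup : ∀ a j → a + j + 2 + 1 ≡ a + 2 + suc j
    regroup = solve-∀
  ... | no x≢u = subst (d S′ x ≤_) (cong (_+ 2) (sym (mass′-other x∈ x≢u)))
                   (≤-trans (degree-other x∈ x≢u) (degree-bound x∈))

  mass-preserved : sumOver mass′ (nodes S′) ≡ sumOver mass Ns
  mass-preserved = +-cancelʳ-≡ a _ _ (begin
      mass′ v + sumOver mass′ Ns + a ≡⟨ cong (λ m → m + sumOver mass′ Ns + a) mass′-v ⟩
      j + sumOver mass′ Ns + a       ≡⟨ regroup j (sumOver mass′ Ns) a ⟩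
      sumOver mass′ Ns + (a + j)     ≡⟨ cong (sumOver mass′ Ns +_) a+j≡mass-u ⟩
      sumOver mass′ Ns + mass u      ≡⟨ sum-update mass mass′ u Ns nodes-unique u∈ mass′-other ⟩
      sumOver mass Ns + mass′ u      ≡⟨ cong (sumOver mass Ns +_) mass′-u ⟩
      sumOver mass Ns + a            ∎)
    where
    open ≡-Reasoning
    regroup : ∀ j s a → j + s + a ≡ s + (a + j)
    regroup = solve-∀

  -- |M| ≤ min(a, j) + 1, and splitting mass a + j into a and j frees at least min(a, j).
  split-pays : length M + (nlog a + nlog j) ≤ 1 + nlog (mass u)
  split-pays = begin
      length M + (nlog a + nlog j)         ≤⟨ +-monoˡ-≤ _ (⊓-glb M≤1+a M≤1+j) ⟩
      suc a ⊓ suc j + (nlog a + nlog j)    ≡⟨ regroup (a ⊓ j) (nlog a) (nlog j) ⟩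
      1 + (nlog a + nlog j + a ⊓ j)        ≤⟨ +-monoʳ-≤ 1 (nlog-merge a j) ⟩
      1 + nlog (a + j)                     ≡⟨ cong (λ m → 1 + nlog m) a+j≡mass-u ⟩
      1 + nlog (mass u)                    ∎
    where
    open ≤-Reasoning
    M≤1+j : length M ≤ suc j
    M≤1+j = subst (length M ≤_) k≡1+j M≤moved
    M≤1+a : length M ≤ suc a
    M≤1+a = +-cancelʳ-≤ k _ _ (begin
      length M + k     ≡⟨ +-comm (length M) k ⟩
      k + length M     ≤⟨ moved+M≤d ⟩
      d S u            ≤⟨ degree-bound u∈ ⟩
      mass u + 2       ≡⟨ cong (_+ 2) a+j≡mass-u ⟨
      a + j + 2        ≡⟨ regroup′ a j ⟩
      suc a + suc j    ≡⟨ cong (suc a +_) k≡1+j ⟨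
      suc a + k        ∎)
      where
      regroup′ : ∀ a j → a + j + 2 ≡ suc a + suc j
      regroup′ = solve-∀
    regroup : ∀ m x y → suc m + (x + y) ≡ 1 + (x + y + m)
    regroup = solve-∀

  amortised : Amortised S mass S′ mass′ (length M) 2
  amortised = amortised-local (length M) 2 (Φwhite S mass) (Φwhite S′ mass′) (Φblack S mass) (Φblack S′ mass′)
      (nlog (mass u)) (nlog a + nlog j) 0 0 ΔW ΔK
      (≤-trans (≤-reflexive (+-identityʳ (length M + (nlog a + nlog j))))
               (≤-trans split-pays (≤-trans (n≤1+n _) (≤-reflexive (sym (+-identityʳ (2 + nlog (mass u))))))))
    where
    ww = whiteWeight S mass
    bw = blackWeight S mass
    ww′ = whiteWeight S′ mass′
    bw′ = blackWeight S′ mass′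
    white-unchanged : ∀ {x} → x ∈ Ns → x ≢ u → ww′ x ≡ ww x
    white-unchanged x∈ x≢u = cong₂ (λ b n → if b then 0 else nlog n) (black′-old x∈) (mass′-other x∈ x≢u)
    -- Old nodes keep their black weight: u stays white, the others keep colour and mass.
    black-unchanged : ∀ {x} → x ∈ Ns → bw′ x ≡ bw x
    black-unchanged {x} x∈ with x ≟ u
    ... | yes refl = trans (cong (λ b → if b then nlog (mass′ u) else 0) (trans (black′-old u∈) u-white))
                           (sym (cong (λ b → if b then nlog (mass u) else 0) u-white))
    ... | no x≢u = cong₂ (λ b n → if b then nlog n else 0) (black′-old x∈) (mass′-other x∈ x≢u)
    white-v : ww′ v ≡ nlog j
    white-v = cong₂ (λ b n → if b then 0 else nlog n) black′-v mass′-v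
    white-u : ww u ≡ nlog (mass u)
    white-u = cong (λ b → if b then 0 else nlog (mass u)) u-white
    white′-u : ww′ u ≡ nlog a
    white′-u = cong₂ (λ b n → if b then 0 else nlog n) (trans (black′-old u∈) u-white) mass′-u
    ΔW : Φwhite S′ mass′ + nlog (mass u) ≡ Φwhite S mass + (nlog a + nlog j)
    ΔW = begin
      ww′ v + sumOver ww′ Ns + nlog (mass u)   ≡⟨ +-assoc (ww′ v) _ _ ⟩
      ww′ v + (sumOver ww′ Ns + nlog (mass u)) ≡⟨ cong₂ (λ x y → x + (sumOver ww′ Ns + y)) white-v (sym white-u) ⟩
      nlog j + (sumOver ww′ Ns + ww u)         ≡⟨ cong (nlog j +_) (sum-update ww ww′ u Ns nodes-unique u∈ white-unchanged) ⟩
      nlog j + (sumOver ww Ns + ww′ u)         ≡⟨ cong (λ y → nlog j + (sumOver ww Ns + y)) white′-u ⟩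
      nlog j + (sumOver ww Ns + nlog a)        ≡⟨ regroup (nlog j) (sumOver ww Ns) (nlog a) ⟩
      sumOver ww Ns + (nlog a + nlog j)        ∎
      where
      open ≡-Reasoning
      regroup : ∀ x s y → x + (s + y) ≡ s + (y + x)
      regroup = solve-∀
    ΔK : Φblack S′ mass′ + 0 ≡ Φblack S mass + 0
    ΔK = cong (_+ 0) (cong₂ _+_ black-v (sum-ext bw′ bw Ns black-unchanged))
      where
      black-v : bw′ v ≡ 0
      black-v = cong (λ b → if b then nlog (mass′ v) else 0) black′-v

  stepBound : AmortisedBound B S mass S′ (length M) 2
  stepBound = record
    { mass′ = mass′
    ; rank′ = rank′
    ; invariant′ = record
      { nodes-unique   = All-tabulate (λ x∈ v≡x → old≢v x∈ (sym v≡x)) ∷ nodes-unique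
      ; below-fresh    = λ { (here refl) → ≤-refl ; (there x∈) → m≤n⇒m≤1+n (below-fresh x∈) }
      ; parent-present = parent-present′
      ; rank-decreases = rank-decreases′
      ; degree-bound   = degree-bound′
      ; mass-bound     = subst (_≤ B) (sym mass-preserved) mass-bound
      }
    ; amortised = amortised
    }

step-bound : ∀ {B S o S′ c mass rank} → Step S o S′ c → Invariant B S mass rank → AmortisedBound B S mass S′ c 2
step-bound (split u∈ u-white _ M-unique M⊆N M≥1 2M≤d) inv = Splitting.stepBound u∈ u-white M-unique M⊆N M≥1 2M≤d inv
step-bound (contract v∈ u∈ v→u) inv = Contraction.stepBound v∈ u∈ v→u inv

exec-bound : ∀ {B S ops S′ cost mass rank} → Exec S ops S′ cost → Invariant B S mass rank →
  AmortisedBound B S mass S′ cost (2 * length ops)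
exec-bound {mass = mass} {rank} done inv = record { mass′ = mass ; rank′ = rank ; invariant′ = inv ; amortised = ≤-refl }
exec-bound {S = S} {ops = _ ∷ ops} {S′ = S″} {mass = mass} (step {S′ = S′} {c = c} {c′ = c′} s e) inv = record
    { mass′      = mass″
    ; rank′      = AmortisedBound.rank′ rest
    ; invariant′ = AmortisedBound.invariant′ rest
    ; amortised  = subst (Amortised S mass S″ mass″ (c + c′)) (sym (*-suc 2 (length ops)))
                     (amortised-compose {S} {S′} {S″} {mass} {AmortisedBound.mass′ first} {mass″} {c} {c′} {2} {2 * length ops}
                        (AmortisedBound.amortised first) (AmortisedBound.amortised rest))
    }
  where
  first = step-bound s inv
  rest  = exec-bound e (AmortisedBound.invariant′ first)
  mass″ = AmortisedBound.mass′ rest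

module Star (B : ℕ) where

  S₀ : State
  S₀ = star B

  mass₀ rank₀ : ℕ → ℕ
  mass₀ w = if w ≡ᵇ 0 then B else 0
  rank₀ w = if w ≡ᵇ 0 then 0 else 1

  data NodeKind (x : ℕ) : Set where
    centre : x ≡ 0 → NodeKind x
    leaf   : x ≢ 0 → par S₀ x ≡ just 0 → mass₀ x ≡ 0 → rank₀ x ≡ 1 → NodeKind x

  nodeKind : ∀ x → NodeKind x
  nodeKind x with x ≡ᵇ 0 in x≡0
  ... | true  = centre (≡ᵇ-sound x≡0)
  ... | false = leaf (λ { refl → true≢false x≡0 }) (cong (λ b → if b then nothing else just 0) x≡0)
                     (cong (λ b → if b then B else 0) x≡0) (cong (λ b → if b then 0 else 1) x≡0)

  no-grandchildren : ∀ {x} → x ≢ 0 → ∀ {w} → w ∈ nodes S₀ → isJust≡ (par S₀ w) x ≡ false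
  no-grandchildren x≢0 {w} _ with nodeKind w
  ... | centre refl = refl
  ... | leaf _ w→0 _ _ = trans (cong (λ mp → isJust≡ mp _) w→0) (≡ᵇ-≢ (x≢0 ∘ sym))

  degree₀ : ∀ x → d S₀ x ≤ mass₀ x + 2
  degree₀ x with nodeKind x
  ... | centre refl = begin
      count (λ w → isJust≡ (par S₀ w) 0) (nodes S₀) ≤⟨ length-filter (T? ∘ λ w → isJust≡ (par S₀ w) 0) (nodes S₀) ⟩
      length (nodes S₀)                             ≡⟨ length-applyUpTo (λ i → i) (suc B) ⟩
      suc B                                         ≤⟨ n≤1+n _ ⟩
      2 + B                                         ≡⟨ +-comm 2 B ⟩
      B + 2                                         ∎
    where open ≤-Reasoning
  ... | leaf x≢0 x→0 mass-0 _ = subst₂ _≤_ (sym degree-1) (cong (_+ 2) (sym mass-0)) (s≤s z≤n)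
    where
    degree-1 : d S₀ x ≡ 1
    degree-1 = trans (degree-split S₀ x)
      (cong₂ _+_ (cong (length ∘ parentList) x→0)
                 (count-none (λ w → isJust≡ (par S₀ w) x) (nodes S₀) (no-grandchildren x≢0)))

  leaves-massless : sumOver mass₀ (nodes S₀) ≡ B
  leaves-massless = trans (cong (B +_) (sum-zero mass₀ _ leaf-mass)) (+-identityʳ B)
    where
    leaf-mass : ∀ {x} → x ∈ applyUpTo suc B → mass₀ x ≡ 0
    leaf-mass x∈ with ∈-applyUpTo⁻ suc x∈
    ... | _ , _ , refl = refl

  invariant₀ : Invariant B S₀ mass₀ rank₀
  invariant₀ = record
    { nodes-unique   = upTo⁺ (suc B)
    ; below-fresh    = ∈-upTo⁻
    ; parent-present = λ {x} _ x→p → parent x x→p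
    ; rank-decreases = λ {x} _ x→p → rank x x→p
    ; degree-bound   = λ {x} _ → degree₀ x
    ; mass-bound     = ≤-reflexive leaves-massless
    }
    where
    parent : ∀ x {p} → par S₀ x ≡ just p → p ∈ nodes S₀
    parent x x→p with nodeKind x
    ... | centre refl = case x→p of λ ()
    ... | leaf _ x→0 _ _ rewrite sym (just-injective (trans (sym x→0) x→p)) = here refl
    rank : ∀ x {p} → par S₀ x ≡ just p → rank₀ p < rank₀ x
    rank x x→p with nodeKind x
    ... | centre refl = case x→p of λ ()
    ... | leaf _ x→0 _ rank-1 rewrite sym (just-injective (trans (sym x→0) x→p)) = subst (0 <_) (sym rank-1) (s≤s z≤n)

-- From the star, the total cost is at most 2 per operation plus 2 nlog B: the white
-- potential starts at most nlog B, and the black potential never exceeds nlog B.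
star-execution-cost : ∀ {B ops S cost} → Exec (star B) ops S cost → cost ≤ 2 * length ops + (nlog B + nlog B)
star-execution-cost {B} {ops} {S} {cost} exec = begin
    cost                                                      ≤⟨ m≤m+n cost _ ⟩
    cost + (Φwhite S massₑ + Φblack S₀ mass₀)                 ≡⟨ +-assoc cost _ _ ⟨
    cost + Φwhite S massₑ + Φblack S₀ mass₀                   ≤⟨ AmortisedBound.amortised bound ⟩
    2 * length ops + Φwhite S₀ mass₀ + Φblack S massₑ         ≡⟨ +-assoc (2 * length ops) _ _ ⟩
    2 * length ops + (Φwhite S₀ mass₀ + Φblack S massₑ)       ≤⟨ +-monoʳ-≤ (2 * length ops) (+-mono-≤ white₀≤ blackₑ≤) ⟩
    2 * length ops + (nlog B + nlog B)                        ∎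
  where
  open ≤-Reasoning
  open Star B
  bound = exec-bound exec invariant₀
  massₑ = AmortisedBound.mass′ bound
  white₀≤ : Φwhite S₀ mass₀ ≤ nlog B
  white₀≤ = subst (Φwhite S₀ mass₀ ≤_) (cong nlog leaves-massless) (weight-≤ _ mass₀ (nodes S₀) (whiteWeight-≤ S₀ mass₀))
  blackₑ≤ : Φblack S massₑ ≤ nlog B
  blackₑ≤ = ≤-trans (weight-≤ _ massₑ (nodes S) (blackWeight-≤ S massₑ))
                    (nlog-mono (Invariant.mass-bound (AmortisedBound.invariant′ bound)))

length-ops : ∀ ops → length ops ≡ numSplits ops + numContracts ops
length-ops [] = refl
length-ops (splitOp _ _ ∷ ops) = cong suc (length-ops ops)
length-ops (contractOp _ _ ∷ ops) = trans (cong suc (length-ops ops)) (sym (+-suc _ _))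

-- B ≤ 1 + B ⌈log₂ B⌉, since ⌈log₂ B⌉ ≥ 1 once B ≥ 2.
B≤1+nlog : ∀ B → B ≤ 1 + nlog B
B≤1+nlog 0 = z≤n
B≤1+nlog 1 = s≤s z≤n
B≤1+nlog B@(suc (suc _)) = m≤n⇒m≤1+n (≤-trans (≤-reflexive (sym (*-identityʳ B))) (*-monoʳ-≤ B log≥1))
  where
  log≥1 : 1 ≤ ⌈log₂ B ⌉
  log≥1 = subst (_≤ ⌈log₂ B ⌉) (⌈log₂2^n⌉≡n 1) (⌈log₂⌉-mono-≤ {2} {B} (s≤s (s≤s z≤n)))

-- With s splits and at most B + s contractions there are at most 2s + 1 + B ⌈log₂ B⌉
-- operations, so the cost is at most 4 (1 + s + B ⌈log₂ B⌉).
lemma30 : ∃ λ (c : ℕ) → ∀ (B : ℕ) (ops : List Op) (S : State) (cost : ℕ) →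
    Exec (star B) ops S cost →
    numContracts ops ≤ B + numSplits ops →
    cost ≤ c * (1 + numSplits ops + B * ⌈log₂ B ⌉)
lemma30 = 4 , λ B ops S cost exec few-contractions →
  let s = numSplits ops
      #ops≤ : length ops ≤ s + (1 + nlog B + s)
      #ops≤ = subst (_≤ s + (1 + nlog B + s)) (sym (length-ops ops))
                (+-monoʳ-≤ s (≤-trans few-contractions (+-monoˡ-≤ s (B≤1+nlog B))))
  in begin
    cost                                       ≤⟨ star-execution-cost exec ⟩
    2 * length ops + (nlog B + nlog B)         ≤⟨ +-monoˡ-≤ (nlog B + nlog B) (*-monoʳ-≤ 2 #ops≤) ⟩
    2 * (s + (1 + nlog B + s)) + (nlog B + nlog B) ≡⟨ regroup₁ s (nlog B) ⟩
    2 + 4 * (s + nlog B)                       ≤⟨ m≤n+m _ 2 ⟩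
    2 + (2 + 4 * (s + nlog B))                 ≡⟨ regroup₂ s (nlog B) ⟩
    4 * (1 + s + nlog B)                       ∎
  where
  open ≤-Reasoning
  regroup₁ : ∀ x y → 2 * (x + (1 + y + x)) + (y + y) ≡ 2 + 4 * (x + y)
  regroup₁ = solve-∀
  regroup₂ : ∀ x y → 2 + (2 + 4 * (x + y)) ≡ 4 * (1 + x + y)
  regroup₂ = solve-∀
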